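{- Let $P$ be an $R$-labeled poset with fixed $R$-labeling $\lambda$, and let $\mathcal{M}$ be a maximal chain in $P$ with $\mathsf{u}(\mathcal{M})=\mathbf{a}\mathbf{b}^j$ for some $j\ge 0$ (so $P$ has rank $j+1$). Then \[ \omega\big(\mathsf{u}(\mathcal{M})\big)=\sum_{E\subseteq\{1,\dots,j+1\}}y^{\#E}\cdot\mathsf{u}(\mathcal{M},E). \]
   Context: A graded poset $P$ of rank $n$ is a finite poset with unique minimum $\hat 0$ (rank $0$) and unique maximum $\hat 1$ (rank $n$) such that ${\sf rank}(X)$ equals the length of every maximal chain from $\hat 0$ to $X$. An $R$-labeling is a map $\lambda$ from cover relations to positive integers such that every interval has a unique maximal chain with weakly increasing labels; $P$ is $R$-labeled if finite, graded and admitting one. Let $\mathbf{a},\mathbf{b}$ be noncommuting variables. For a maximal chain $\mathcal{M}=\{\mathcal{M}_0\lessdot\dots\lessdot\mathcal{M}_n\}$, $\mathsf{u}(\mathcal{M})=u_1\cdots u_n$ with $u_1=\mathbf{a}$ and, for $2\le i\le n$, $u_i=\mathbf{a}$ if $\lambda(\mathcal{M}_{i-2},\mathcal{M}_{i-1})\le\lambda(\mathcal{M}_{i-1},\mathcal{M}_i)$, else $\mathbf{b}$. For $E\subseteq\{1,\dots,n\}$, $\mathsf{u}(\mathcal{M},E)=v_1\cdots v_n$ with $v_i=\mathbf{a}$ if ($u_i=\mathbf{a}$, $i\notin E$) or ($u_i=\mathbf{b}$, $i-1\in E$), and $v_i=\mathbf{b}$ if ($u_i=\mathbf{a}$, $i\in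 E$) or ($u_i=\mathbf{b}$, $i-1\notin E$). For a monomial in $\mathbf{a},\mathbf{b}$, $\omega$ replaces all occurrences of $\mathbf{a}\mathbf{b}$ with $\mathbf{a}\mathbf{b}+y\mathbf{b}\mathbf{a}+y\mathbf{a}\mathbf{b}+y^2\mathbf{b}\mathbf{a}$ and then simultaneously replaces all remaining $\mathbf{a}$ with $\mathbf{a}+y\mathbf{b}$ and all remaining $\mathbf{b}$ with $\mathbf{b}+y\mathbf{a}$. -}

module Defs where

open import Data.Nat using (ℕ; zero; suc; _≤_; _≤ᵇ_; _+_; _∸_)
open import Data.Bool using (Bool; true; false; if_then_else_)
open import Data.Fin using (Fin)
open import Data.Fin.Subset using (Subset; ∣_∣)
open import Data.List using (List; []; _∷_; _++_; map; concatMap; length; [_])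
open import Data.Vec using (Vec; fromList; toList) renaming ([] to []ᵥ; _∷_ to _∷ᵥ_)
open import Data.Product using (Σ; ∃; _×_; _,_)
open import Data.Empty using (⊥)
open import Data.List.Relation.Unary.Linked using (Linked)
open import Relation.Binary.PropositionalEquality using (_≡_; _≢_)
open import Relation.Binary.Structures using (IsPartialOrder)

record FinPoset : Set₁ where
  field
    N              : ℕ
    _≤ₚ_           : Fin N → Fin N → Set
    isPartialOrder : IsPartialOrder _≡_ _≤ₚ_

module PosetNotions (P : FinPoset) where
  open FinPoset P

  _<ₚ_ : Fin N → Fin N → Set
  x <ₚ y = x ≤ₚ y × x ≢ y

  _⋖_ : Fin N → Fin N → Set
  x ⋖ y = x <ₚ y × (∀ z → x <ₚ z → z <ₚ y → ⊥)

  data SatChain : Fin N → Fin N → List (Fin N) → Set where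
    sc-one  : ∀ x → SatChain x x (x ∷ [])
    sc-step : ∀ {x z y cs} → x ⋖ z → SatChain z y cs → SatChain x y (x ∷ cs)

  chainLength : List (Fin N) → ℕ
  chainLength cs = length cs ∸ 1

  record IsGraded (n : ℕ) : Set where
    field
      0̂          : Fin N
      1̂          : Fin N
      0̂-min      : ∀ x → 0̂ ≤ₚ x
      1̂-max      : ∀ x → x ≤ₚ 1̂
      rank        : Fin N → ℕ
      rank-1̂     : rank 1̂ ≡ n
      rank-chains : ∀ X cs → SatChain 0̂ X cs → chainLength cs ≡ rank X

  labels : (Fin N → Fin N → ℕ) → List (Fin N) → List ℕ
  labels lab (x ∷ y ∷ cs) = lab x y ∷ labels lab (y ∷ cs)
  labels lab _            = []

  IsRLabeling : (Fin N → Fin N → ℕ) → Set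
  IsRLabeling lab =
    (∀ x y → x ⋖ y → 1 ≤ lab x y) ×
    (∀ x y → x ≤ₚ y →
       Σ (List (Fin N)) λ cs → SatChain x y cs × Linked _≤_ (labels lab cs) ×
         (∀ cs′ → SatChain x y cs′ → Linked _≤_ (labels lab cs′) → cs′ ≡ cs))

data Letter : Set where
  𝐚 𝐛 : Letter

Word : Set
Word = List Letter

ascents : List ℕ → Word
ascents (l₁ ∷ l₂ ∷ ls) = (if l₁ ≤ᵇ l₂ then 𝐚 else 𝐛) ∷ ascents (l₂ ∷ ls)
ascents _              = []

uWord : List ℕ → Word
uWord []       = []
uWord (l ∷ ls) = 𝐚 ∷ ascents (l ∷ ls)

-- u(M,E); the Bool argument records whether i-1 ∈ E (initially 0 ∉ E)
uE′ : ∀ {n} → Bool → Vec Letter n → Subset n → Vec Letter n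
uE′ prev []ᵥ       []ᵥ       = []ᵥ
uE′ prev (𝐚 ∷ᵥ u) (e ∷ᵥ E) = (if e then 𝐛 else 𝐚) ∷ᵥ uE′ e u E
uE′ prev (𝐛 ∷ᵥ u) (e ∷ᵥ E) = (if prev then 𝐚 else 𝐛) ∷ᵥ uE′ e u E

uE : (w : Word) → Subset (length w) → Word
uE w E = toList (uE′ false (fromList w) E)

-- Polynomials in y with ℕ-coefficients over noncommutative words,
-- represented as bags (lists up to permutation) of terms (k , w) = y^k · w

Term : Set
Term = ℕ × Word

Poly : Set
Poly = List Term

_*ᵗ_ : Term → Term → Term
(k , u) *ᵗ (l , v) = (k + l , u ++ v)

_*ₚ_ : Poly → Poly → Poly
p *ₚ q = concatMap (λ s → map (s *ᵗ_) q) p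

ω : Word → Poly
ω []           = [ (0 , []) ]
ω (𝐚 ∷ 𝐛 ∷ w) = ((0 , 𝐚 ∷ 𝐛 ∷ []) ∷ (1 , 𝐛 ∷ 𝐚 ∷ []) ∷ (1 , 𝐚 ∷ 𝐛 ∷ []) ∷ (2 , 𝐛 ∷ 𝐚 ∷ []) ∷ []) *ₚ ω w
ω (𝐚 ∷ w)      = ((0 , 𝐚 ∷ []) ∷ (1 , 𝐛 ∷ []) ∷ []) *ₚ ω w
ω (𝐛 ∷ w)      = ((0 , 𝐛 ∷ []) ∷ (1 , 𝐚 ∷ []) ∷ []) *ₚ ω w

subsets : ∀ n → List (Subset n)
subsets zero    = [ []ᵥ ]
subsets (suc n) = map (true ∷ᵥ_) (subsets n) ++ map (false ∷ᵥ_) (subsets n)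

sumOverE : Word → Poly
sumOverE w = map (λ E → (∣ E ∣ , uE w E)) (subsets (length w))

{-# OPTIONS --safe #-}
module Submission where

-- In u(𝐚𝐛ʲ, E) the first letter is 𝐛 iff 1 ∈ E, and the letter at a position i ≥ 2 is 𝐚
-- iff i − 1 ∈ E. Hence 1 ∈ E turns the prefix 𝐚𝐛 into y𝐛𝐚, each i ∈ E with 2 ≤ i ≤ j turns
-- the 𝐛 at position i + 1 into y𝐚, and j + 1 ∈ E only contributes a factor y. The sum is
-- therefore (𝐚𝐛 + y𝐛𝐚)(𝐛 + y𝐚)ʲ⁻¹(1 + y), which is ω(𝐚𝐛ʲ) because y is central.
-- The poset and its labeling enter only through the word 𝐚𝐛ʲ.

open import Defs
open import Data.Nat using (ℕ; zero; suc)
open import Data.Fin using (Fin)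
open import Data.Bool using (Bool; true; false; if_then_else_)
open import Data.Product using (_,_)
open import Data.Fin.Subset using (Subset; ∣_∣)
open import Data.Vec using (fromList; toList) renaming (_∷_ to _∷ᵥ_)
open import Data.List using (List; []; _∷_; replicate; map; _++_; length)
open import Data.List.Properties using (map-++; map-∘; map-cong; ++-identityʳ)
open import Data.List.Relation.Binary.Permutation.Propositional
  using (_↭_; ↭-refl; swap; module PermutationReasoning)
open import Data.List.Relation.Binary.Permutation.Propositional.Properties
  using (map⁺; ++⁺; ++-comm; ++-assoc; ++-commutativeMonoid)
open import Algebra.Bundles using (CommutativeMonoid)
open import Algebra.Properties.CommutativeSemigroup
  (CommutativeMonoid.commutativeSemigroup (++-commutativeMonoid {A = Term}))
  using (interchange)
open import Relation.Binary.PropositionalEquality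
  using (_≡_; refl; sym; trans; cong; cong₂; module ≡-Reasoning)
open import Function using (_∘_)

infixr 5 _∷ᵗ_
infix 6 y·_

_∷ᵗ_ : Letter → Term → Term
c ∷ᵗ (k , w) = (k , c ∷ w)

y·_ : Term → Term
y· (k , w) = (suc k , w)

[1+y]_ : Poly → Poly
[1+y] p = p ++ map y·_ p

map-[1+y] : ∀ (f : Term → Term) → (∀ t → f (y· t) ≡ y· f t) →
            ∀ p → map f ([1+y] p) ≡ [1+y] map f p
map-[1+y] f f-y· p = begin
  map f (p ++ map y·_ p)          ≡⟨ map-++ f p (map y·_ p) ⟩
  map f p ++ map f (map y·_ p)    ≡⟨ cong (map f p ++_) (sym (map-∘ p)) ⟩
  map f p ++ map (f ∘ y·_) p      ≡⟨ cong (map f p ++_) (map-cong f-y· p) ⟩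
  map f p ++ map (y·_ ∘ f) p      ≡⟨ cong (map f p ++_) (map-∘ p) ⟩
  map f p ++ map y·_ (map f p)    ∎
  where open ≡-Reasoning

[1+y]-++ : ∀ p q → [1+y] (p ++ q) ↭ [1+y] p ++ [1+y] q
[1+y]-++ p q = begin
  (p ++ q) ++ map y·_ (p ++ q)           ≡⟨ cong ((p ++ q) ++_) (map-++ y·_ p q) ⟩
  (p ++ q) ++ (map y·_ p ++ map y·_ q)   ↭⟨ interchange p q (map y·_ p) (map y·_ q) ⟩
  [1+y] p ++ [1+y] q                     ∎
  where open PermutationReasoning

ω-𝐛∷ : ∀ w → ω (𝐛 ∷ w) ≡ map (𝐛 ∷ᵗ_) (ω w) ++ map (y·_ ∘ (𝐚 ∷ᵗ_)) (ω w)
ω-𝐛∷ w = cong (map (𝐛 ∷ᵗ_) (ω w) ++_) (++-identityʳ _)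

ω-𝐚𝐛∷ : ∀ w → ω (𝐚 ∷ 𝐛 ∷ w)
        ↭ [1+y] (map ((𝐚 ∷ᵗ_) ∘ (𝐛 ∷ᵗ_)) (ω w) ++ map (y·_ ∘ (𝐛 ∷ᵗ_) ∘ (𝐚 ∷ᵗ_)) (ω w))
ω-𝐚𝐛∷ w = begin
  ab ++ yba ++ yab ++ yyba ++ []   ≡⟨ cong (λ r → ab ++ yba ++ yab ++ r) (++-identityʳ yyba) ⟩
  ab ++ yba ++ yab ++ yyba         ↭⟨ ++-assoc ab yba (yab ++ yyba) ⟨
  (ab ++ yba) ++ yab ++ yyba       ≡⟨ cong ((ab ++ yba) ++_) (sym (y·[ab++yba])) ⟩
  [1+y] (ab ++ yba)                ∎
  where
  open PermutationReasoning
  ab yba yab yyba : Poly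
  ab   = map ((𝐚 ∷ᵗ_) ∘ (𝐛 ∷ᵗ_)) (ω w)
  yba  = map (y·_ ∘ (𝐛 ∷ᵗ_) ∘ (𝐚 ∷ᵗ_)) (ω w)
  yab  = map (y·_ ∘ (𝐚 ∷ᵗ_) ∘ (𝐛 ∷ᵗ_)) (ω w)
  yyba = map (y·_ ∘ y·_ ∘ (𝐛 ∷ᵗ_) ∘ (𝐚 ∷ᵗ_)) (ω w)
  y·[ab++yba] : map y·_ (ab ++ yba) ≡ yab ++ yyba
  y·[ab++yba] = trans (map-++ y·_ ab yba) (cong₂ _++_ (sym (map-∘ (ω w))) (sym (map-∘ (ω w))))

map-subsets-suc : ∀ {A : Set} n (f : Subset (suc n) → A) →
                  map f (subsets (suc n))
                  ≡ map (f ∘ (true ∷ᵥ_)) (subsets n) ++ map (f ∘ (false ∷ᵥ_)) (subsets n)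
map-subsets-suc n f = trans (map-++ f (map (true ∷ᵥ_) (subsets n)) (map (false ∷ᵥ_) (subsets n)))
                            (cong₂ _++_ (sym (map-∘ (subsets n))) (sym (map-∘ (subsets n))))

-- Σ_E y^#E u(𝐛ᵏ, E), where the flag says whether the index preceding the word lies in E.
sumOverE𝐛 : Bool → ℕ → Poly
sumOverE𝐛 prev k = map (λ E → (∣ E ∣ , toList (uE′ prev (fromList (replicate k 𝐛)) E)))
                       (subsets (length (replicate k 𝐛)))

sumOverE𝐛-suc : ∀ prev k → let c = if prev then 𝐚 else 𝐛 in
                sumOverE𝐛 prev (suc k)
                ≡ map (y·_ ∘ (c ∷ᵗ_)) (sumOverE𝐛 true k) ++ map (c ∷ᵗ_) (sumOverE𝐛 false k)
sumOverE𝐛-suc prev k = trans (map-subsets-suc _ _) (cong₂ _++_ (map-∘ s) (map-∘ s))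
  where
  s : List (Subset (length (replicate k 𝐛)))
  s = subsets (length (replicate k 𝐛))

sumOverE𝐛⁺ : ℕ → Poly
sumOverE𝐛⁺ k = sumOverE𝐛 false k ++ map y·_ (sumOverE𝐛 true k)

sumOverE𝐛-suc-↭ : ∀ prev k → let c = if prev then 𝐚 else 𝐛 in
                  sumOverE𝐛 prev (suc k) ↭ map (c ∷ᵗ_) (sumOverE𝐛⁺ k)
sumOverE𝐛-suc-↭ prev k = begin
  sumOverE𝐛 prev (suc k)                      ≡⟨ sumOverE𝐛-suc prev k ⟩
  map (y·_ ∘ (c ∷ᵗ_)) T ++ map (c ∷ᵗ_) F      ↭⟨ ++-comm (map (y·_ ∘ (c ∷ᵗ_)) T) (map (c ∷ᵗ_) F) ⟩
  map (c ∷ᵗ_) F ++ map ((c ∷ᵗ_) ∘ y·_) T      ≡⟨ cong (map (c ∷ᵗ_) F ++_) (map-∘ T) ⟩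
  map (c ∷ᵗ_) F ++ map (c ∷ᵗ_) (map y·_ T)    ≡⟨ map-++ (c ∷ᵗ_) F (map y·_ T) ⟨
  map (c ∷ᵗ_) (sumOverE𝐛⁺ k)                  ∎
  where
  open PermutationReasoning
  c : Letter
  c = if prev then 𝐚 else 𝐛
  T F : Poly
  T = sumOverE𝐛 true k
  F = sumOverE𝐛 false k

sumOverE𝐛⁺-↭ : ∀ k → sumOverE𝐛⁺ k ↭ [1+y] ω (replicate k 𝐛)
sumOverE𝐛⁺-↭ zero    = ↭-refl
sumOverE𝐛⁺-↭ (suc k) = begin
  sumOverE𝐛 false (suc k) ++ map y·_ (sumOverE𝐛 true (suc k))
    ↭⟨ ++⁺ (sumOverE𝐛-suc-↭ false k) (map⁺ y·_ (sumOverE𝐛-suc-↭ true k)) ⟩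
  map (𝐛 ∷ᵗ_) X ++ map y·_ (map (𝐚 ∷ᵗ_) X)
    ≡⟨ cong (map (𝐛 ∷ᵗ_) X ++_) (map-∘ X) ⟨
  map (𝐛 ∷ᵗ_) X ++ map (y·_ ∘ (𝐚 ∷ᵗ_)) X
    ↭⟨ ++⁺ (map⁺ (𝐛 ∷ᵗ_) (sumOverE𝐛⁺-↭ k)) (map⁺ (y·_ ∘ (𝐚 ∷ᵗ_)) (sumOverE𝐛⁺-↭ k)) ⟩
  map (𝐛 ∷ᵗ_) ([1+y] Ω) ++ map (y·_ ∘ (𝐚 ∷ᵗ_)) ([1+y] Ω)
    ≡⟨ cong₂ _++_ (map-[1+y] (𝐛 ∷ᵗ_) (λ _ → refl) Ω)
                  (map-[1+y] (y·_ ∘ (𝐚 ∷ᵗ_)) (λ _ → refl) Ω) ⟩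
  [1+y] map (𝐛 ∷ᵗ_) Ω ++ [1+y] map (y·_ ∘ (𝐚 ∷ᵗ_)) Ω
    ↭⟨ [1+y]-++ (map (𝐛 ∷ᵗ_) Ω) (map (y·_ ∘ (𝐚 ∷ᵗ_)) Ω) ⟨
  [1+y] (map (𝐛 ∷ᵗ_) Ω ++ map (y·_ ∘ (𝐚 ∷ᵗ_)) Ω)
    ≡⟨ cong [1+y]_ (ω-𝐛∷ (replicate k 𝐛)) ⟨
  [1+y] ω (replicate (suc k) 𝐛)
    ∎
  where
  open PermutationReasoning
  X Ω : Poly
  X = sumOverE𝐛⁺ k
  Ω = ω (replicate k 𝐛)

sumOverE-𝐚𝐛ᵏ : ∀ k → sumOverE (𝐚 ∷ replicate k 𝐛)
               ≡ map (y·_ ∘ (𝐛 ∷ᵗ_)) (sumOverE𝐛 true k) ++ map (𝐚 ∷ᵗ_) (sumOverE𝐛 false k)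
sumOverE-𝐚𝐛ᵏ k = trans (map-subsets-suc _ _) (cong₂ _++_ (map-∘ s) (map-∘ s))
  where
  s : List (Subset (length (replicate k 𝐛)))
  s = subsets (length (replicate k 𝐛))

ω-𝐚𝐛ʲ↭sumOverE : ∀ j → ω (𝐚 ∷ replicate j 𝐛) ↭ sumOverE (𝐚 ∷ replicate j 𝐛)
ω-𝐚𝐛ʲ↭sumOverE zero    = swap _ _ ↭-refl
ω-𝐚𝐛ʲ↭sumOverE (suc k) = begin
  ω (𝐚 ∷ 𝐛 ∷ replicate k 𝐛)                              ↭⟨ ω-𝐚𝐛∷ (replicate k 𝐛) ⟩
  [1+y] (map ab Ω ++ map yba Ω)                           ↭⟨ [1+y]-++ (map ab Ω) (map yba Ω) ⟩
  [1+y] map ab Ω ++ [1+y] map yba Ω                       ↭⟨ ++-comm ([1+y] map ab Ω) ([1+y] map yba Ω) ⟩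
  [1+y] map yba Ω ++ [1+y] map ab Ω                       ≡⟨ cong₂ _++_ (map-[1+y] yba (λ _ → refl) Ω)
                                                                        (map-[1+y] ab (λ _ → refl) Ω) ⟨
  map yba ([1+y] Ω) ++ map ab ([1+y] Ω)                   ↭⟨ ++⁺ (map⁺ yba (sumOverE𝐛⁺-↭ k))
                                                                 (map⁺ ab (sumOverE𝐛⁺-↭ k)) ⟨
  map yba X ++ map ab X                                   ≡⟨ cong₂ _++_ (map-∘ X) (map-∘ X) ⟩
  map (y·_ ∘ (𝐛 ∷ᵗ_)) (map (𝐚 ∷ᵗ_) X) ++ map (𝐚 ∷ᵗ_) (map (𝐛 ∷ᵗ_) X)
    ↭⟨ ++⁺ (map⁺ (y·_ ∘ (𝐛 ∷ᵗ_)) (sumOverE𝐛-suc-↭ true k))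
           (map⁺ (𝐚 ∷ᵗ_) (sumOverE𝐛-suc-↭ false k)) ⟨
  map (y·_ ∘ (𝐛 ∷ᵗ_)) (sumOverE𝐛 true (suc k)) ++ map (𝐚 ∷ᵗ_) (sumOverE𝐛 false (suc k))
    ≡⟨ sumOverE-𝐚𝐛ᵏ (suc k) ⟨
  sumOverE (𝐚 ∷ 𝐛 ∷ replicate k 𝐛)                       ∎
  where
  open PermutationReasoning
  ab yba : Term → Term
  ab  = (𝐚 ∷ᵗ_) ∘ (𝐛 ∷ᵗ_)
  yba = y·_ ∘ (𝐛 ∷ᵗ_) ∘ (𝐚 ∷ᵗ_)
  X Ω : Poly
  X = sumOverE𝐛⁺ k
  Ω = ω (replicate k 𝐛)

lemma4p3 : (P : FinPoset) (n : ℕ) (G : PosetNotions.IsGraded P n)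
    (lab : Fin (FinPoset.N P) → Fin (FinPoset.N P) → ℕ) → PosetNotions.IsRLabeling P lab →
    (M : List (Fin (FinPoset.N P))) →
    PosetNotions.SatChain P (PosetNotions.IsGraded.0̂ G) (PosetNotions.IsGraded.1̂ G) M →
    (j : ℕ) → uWord (PosetNotions.labels P lab M) ≡ 𝐚 ∷ replicate j 𝐛 →
    ω (uWord (PosetNotions.labels P lab M)) ↭ sumOverE (uWord (PosetNotions.labels P lab M))
lemma4p3 P _ G lab _ M _ j u≡𝐚𝐛ʲ rewrite u≡𝐚𝐛ʲ = ω-𝐚𝐛ʲ↭sumOverE j
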